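{- Let $R$ be a commutative ring, $q\in R$ with $R$ $q$-torsion free and $qR$ a prime ideal, and let $d\geq 2$. The kernel $N_d(R,q)$ of the reduction homomorphism $\pi_d: A_d(R,q)\to A_{d-1}(R,q)$ (reduction modulo $q^{d-1}$) is isomorphic to the additive group $(R/q)^{d+1}$, via $$T+q^{d-1}(a_0+a_1T+a_2T^2+\cdots+a_dT^d)\bmod q^d\ \mapsto\ (a_0,a_1,\ldots,a_d).$$
   Context: For a commutative ring $B$, $\mathrm{Aut}(\mathbb{A}^1_B)$ denotes the group of polynomials $f\in B[T]$ invertible under composition, with group law composition. For $d\geq1$, $A_d(R,q)$ is the subgroup of $\mathrm{Aut}(\mathbb{A}^1_{R/q^d})$ consisting of invertible polynomials of the form $a_0+a_1T+qa_2T^2+q^2a_3T^3+\cdots+q^{d-1}a_dT^d \bmod q^d$ with $a_i\in R$. -}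

module Defs where

open import Level using (_⊔_)
open import Algebra.Bundles using (CommutativeRing)
open import Data.Nat using (ℕ; zero; suc; _∸_)
open import Data.Fin using (Fin; toℕ)
open import Data.List using (List; []; _∷_; tabulate; map)
open import Data.Product using (∃; _×_)
open import Data.Sum using (_⊎_)
open import Relation.Nullary using (¬_)

-- Polynomials over a commutative ring R, represented by coefficient lists
-- (constant term first).  Polynomials over R/m are represented by lifts to
-- R[T], with equality "coefficientwise congruent modulo m".
module WithRing {c ℓ} (R : CommutativeRing c ℓ) where
  open CommutativeRing R

  Poly : Set c
  Poly = List Carrier

  pow : Carrier → ℕ → Carrier
  pow x zero = 1#
  pow x (suc n) = x * pow x n

  Divides : Carrier → Carrier → Set (c ⊔ ℓ)
  Divides m x = ∃ λ k → x ≈ m * k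

  Cong : Carrier → Carrier → Carrier → Set (c ⊔ ℓ)
  Cong m x y = Divides m (x - y)

  coeff : ℕ → Poly → Carrier
  coeff n [] = 0#
  coeff zero (a ∷ p) = a
  coeff (suc n) (a ∷ p) = coeff n p

  PolyCong : Carrier → Poly → Poly → Set (c ⊔ ℓ)
  PolyCong m f g = ∀ n → Cong m (coeff n f) (coeff n g)

  _⊕_ : Poly → Poly → Poly
  [] ⊕ g = g
  (a ∷ f) ⊕ [] = a ∷ f
  (a ∷ f) ⊕ (b ∷ g) = (a + b) ∷ (f ⊕ g)

  scale : Carrier → Poly → Poly
  scale x = map (x *_)

  _⊗_ : Poly → Poly → Poly
  [] ⊗ g = []
  (a ∷ f) ⊗ g = scale a g ⊕ (0# ∷ (f ⊗ g))

  _∘ₚ_ : Poly → Poly → Poly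
  [] ∘ₚ g = []
  (a ∷ f) ∘ₚ g = (a ∷ []) ⊕ (g ⊗ (f ∘ₚ g))

  X : Poly
  X = 0# ∷ 1# ∷ []

  -- f mod m lies in Aut(A^1_{R/m}): invertible under composition in (R/m)[T]
  InvertibleMod : Carrier → Poly → Set (c ⊔ ℓ)
  InvertibleMod m f = ∃ λ g → PolyCong m (f ∘ₚ g) X × PolyCong m (g ∘ₚ f) X

  TorsionFree : Carrier → Set (c ⊔ ℓ)
  TorsionFree q = ∀ x → q * x ≈ 0# → x ≈ 0#

  PrincipalPrime : Carrier → Set (c ⊔ ℓ)
  PrincipalPrime q = ¬ Divides q 1# × (∀ x y → Divides q (x * y) → Divides q x ⊎ Divides q y)

  shapePoly : Carrier → (d : ℕ) → (Fin (suc d) → Carrier) → Poly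
  shapePoly q d a = tabulate (λ i → pow q (toℕ i ∸ 1) * a i)

  InA : Carrier → ℕ → Poly → Set (c ⊔ ℓ)
  InA q d f = InvertibleMod (pow q d) f
            × (∃ λ (a : Fin (suc d) → Carrier) → PolyCong (pow q d) f (shapePoly q d a))

  InN : Carrier → ℕ → Poly → Set (c ⊔ ℓ)
  InN q d f = InA q d f × PolyCong (pow q (d ∸ 1)) f X

  nEmbed : Carrier → (d : ℕ) → (Fin (suc d) → Carrier) → Poly
  nEmbed q d a = X ⊕ scale (pow q (d ∸ 1)) (tabulate a)

-- Put ε = q^(d-1) and call  T + εA  (= X ⊕ scale ε A)  a perturbation of the
-- identity; nEmbed q d a is the perturbation by A = a_0 + ... + a_d T^d.
-- For d ≥ 2 the modulus q^d divides ε², and everything rests on the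
-- first-order computation
--     (T + εA) ∘ (T + εB) = (T + εB) + ε·A(T + εB) ≡ T + ε(A + B)   (mod q^d),
-- valid because A(T + εB) ≡ A(T) (mod ε).  Hence perturbations compose by
-- adding their perturbing terms, T + ε(-A) is inverse to T + εA, and, ε being
-- a non-zero-divisor when R is q-torsion free, T + εA ≡ T + εB (mod qε) iff
-- A ≡ B (mod q).  Conversely an element of N_d has degree ≤ d modulo q^d and
-- is ≡ T modulo ε, so it is such a perturbation.
--
-- The lemma is then assembled from
-- these with ε = q^(d-1) and q^d = q·ε.

module Submission where

open import Defs
open import Level using (_⊔_)
open import Algebra.Bundles using (CommutativeRing)
open import Data.Nat as ℕ using (ℕ; zero; suc; _∸_; _≤_; z≤n; s≤s)
open import Data.Nat.Properties using (m+[n∸m]≡n)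
open import Data.Fin using (Fin; toℕ; zero; suc)
open import Data.Fin.Properties using (toℕ≤pred[n])
open import Data.List using ([]; _∷_; tabulate; length)
open import Data.List.Properties using (map-tabulate)
open import Data.Product using (∃; _×_; _,_; proj₁)
open import Data.Maybe using (nothing)
open import Function using (_∘_)
open import Relation.Binary.Bundles using (Setoid)
import Relation.Binary.PropositionalEquality as P
import Relation.Binary.Reasoning.Setoid as SetoidReasoning
open import Tactic.RingSolver.Core.AlmostCommutativeRing using (fromCommutativeRing)

module Solver {c ℓ} (R : CommutativeRing c ℓ) where
  open import Tactic.RingSolver.NonReflective (fromCommutativeRing R (λ _ → nothing)) public
    using (solve; _⊜_) renaming (_⊕_ to _:+_; _⊗_ to _:*_)

-- Congruence modulo an element m of R, i.e. equality in R/mR.  Every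
-- congruence is handled through its witness form  x ≈ y + m·k.
module Congruence {c ℓ} (R : CommutativeRing c ℓ) where
  open CommutativeRing R
  open WithRing R
  open Solver R
  open SetoidReasoning setoid
  open import Algebra.Properties.Group +-group
    using (//-rightDividesˡ; //-rightDividesʳ; ∙-cancelˡ; x∙y⁻¹≈ε⇒x≈y)
  open import Algebra.Properties.Ring ring using (-‿distribʳ-*)
  open import Algebra.Properties.CommutativeSemigroup *-commutativeSemigroup using (x∙yz≈yx∙z)

  module _ {m : Carrier} where
    Cong-intro : ∀ {x y} k → x ≈ y + m * k → Cong m x y
    Cong-intro {x} {y} k e = k , (begin
      x - y            ≈⟨ +-congʳ (trans e (+-comm y (m * k))) ⟩
      (m * k + y) - y  ≈⟨ //-rightDividesʳ y (m * k) ⟩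
      m * k            ∎)

    Cong-witness : ∀ {x y} (h : Cong m x y) → x ≈ y + m * proj₁ h
    Cong-witness {x} {y} (k , e) = begin
      x            ≈⟨ //-rightDividesˡ y x ⟨
      (x - y) + y  ≈⟨ +-congʳ e ⟩
      m * k + y    ≈⟨ +-comm (m * k) y ⟩
      y + m * k    ∎

    ≈⇒Cong : ∀ {x y} → x ≈ y → Cong m x y
    ≈⇒Cong {x} {y} x≈y = Cong-intro 0# (begin
      x           ≈⟨ x≈y ⟩
      y           ≈⟨ +-identityʳ y ⟨
      y + 0#      ≈⟨ +-congˡ (zeroʳ m) ⟨
      y + m * 0#  ∎)

    Cong-refl : ∀ {x} → Cong m x x
    Cong-refl = ≈⇒Cong refl

    Cong-sym : ∀ {x y} → Cong m x y → Cong m y x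
    Cong-sym {x} {y} h@(k , _) = Cong-intro (- k) (sym (begin
      x + m * - k              ≈⟨ +-congʳ (Cong-witness h) ⟩
      (y + m * k) + m * - k    ≈⟨ solve 4 (λ y m k k' → ((y :+ (m :* k)) :+ (m :* k')) ⊜ (y :+ (m :* (k :+ k')))) refl y m k (- k) ⟩
      y + m * (k - k)          ≈⟨ +-congˡ (trans (*-congˡ (-‿inverseʳ k)) (zeroʳ m)) ⟩
      y + 0#                   ≈⟨ +-identityʳ y ⟩
      y                        ∎))

    Cong-trans : ∀ {x y z} → Cong m x y → Cong m y z → Cong m x z
    Cong-trans {x} {y} {z} h@(k , _) h'@(k' , _) = Cong-intro (k' + k) (begin
      x                       ≈⟨ Cong-witness h ⟩
      y + m * k               ≈⟨ +-congʳ (Cong-witness h') ⟩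
      (z + m * k') + m * k    ≈⟨ solve 4 (λ z m k' k → ((z :+ (m :* k')) :+ (m :* k)) ⊜ (z :+ (m :* (k' :+ k)))) refl z m k' k ⟩
      z + m * (k' + k)        ∎)

    Cong-resp : ∀ {x x' y y'} → x ≈ x' → y ≈ y' → Cong m x' y' → Cong m x y
    Cong-resp x≈x' y≈y' h = Cong-trans (≈⇒Cong x≈x') (Cong-trans h (≈⇒Cong (sym y≈y')))

    Cong-+ : ∀ {x x' y y'} → Cong m x y → Cong m x' y' → Cong m (x + x') (y + y')
    Cong-+ {x} {x'} {y} {y'} h@(k , _) h'@(k' , _) = Cong-intro (k + k') (begin
      x + x'                      ≈⟨ +-cong (Cong-witness h) (Cong-witness h') ⟩
      (y + m * k) + (y' + m * k') ≈⟨ solve 5 (λ y y' m k k' → ((y :+ (m :* k)) :+ (y' :+ (m :* k'))) ⊜ ((y :+ y') :+ (m :* (k :+ k')))) refl y y' m k k' ⟩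
      (y + y') + m * (k + k')     ∎)

    Cong-*ˡ : ∀ z {x y} → Cong m x y → Cong m (z * x) (z * y)
    Cong-*ˡ z {x} {y} h@(k , _) = Cong-intro (z * k) (begin
      z * x                ≈⟨ *-congˡ (Cong-witness h) ⟩
      z * (y + m * k)      ≈⟨ solve 4 (λ z y m k → (z :* (y :+ (m :* k))) ⊜ ((z :* y) :+ (m :* (z :* k)))) refl z y m k ⟩
      z * y + m * (z * k)  ∎)

    Cong-*ʳ : ∀ z {x y} → Cong m x y → Cong m (x * z) (y * z)
    Cong-*ʳ z h = Cong-resp (*-comm _ z) (*-comm _ z) (Cong-*ˡ z h)

    Cong-addMultiple : ∀ x b → Cong m (x + m * b) x
    Cong-addMultiple x b = Cong-intro b refl

    Cong-cancelˡ : ∀ z {x y} → Cong m (z + x) (z + y) → Cong m x y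
    Cong-cancelˡ z {x} {y} h@(k , _) = Cong-intro k (∙-cancelˡ z x (y + m * k) (begin
      z + x              ≈⟨ Cong-witness h ⟩
      (z + y) + m * k    ≈⟨ +-assoc z y (m * k) ⟩
      z + (y + m * k)    ∎))

  Cong-divides : ∀ {m r x y} → Divides m r → Cong r x y → Cong m x y
  Cong-divides {m} {r} {x} {y} (k , r≈mk) h@(t , _) = Cong-intro (k * t) (begin
    x                ≈⟨ Cong-witness h ⟩
    y + r * t        ≈⟨ +-congˡ (*-congʳ r≈mk) ⟩
    y + (m * k) * t  ≈⟨ +-congˡ (*-assoc m k t) ⟩
    y + m * (k * t)  ∎)

  Cong-scale : ∀ ε {r x y} → Cong r x y → Cong (r * ε) (ε * x) (ε * y)
  Cong-scale ε {r} {x} {y} h@(t , _) = Cong-intro t (begin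
    ε * x                ≈⟨ *-congˡ (Cong-witness h) ⟩
    ε * (y + r * t)      ≈⟨ distribˡ ε y (r * t) ⟩
    ε * y + ε * (r * t)  ≈⟨ +-congˡ (x∙yz≈yx∙z ε r t) ⟩
    ε * y + (r * ε) * t  ∎)

  TorsionFree-cancel : ∀ {ε x y} → TorsionFree ε → ε * x ≈ ε * y → x ≈ y
  TorsionFree-cancel {ε} {x} {y} ε-regular εx≈εy = x∙y⁻¹≈ε⇒x≈y x y (ε-regular (x - y) (begin
    ε * (x - y)        ≈⟨ distribˡ ε x (- y) ⟩
    ε * x + ε * - y    ≈⟨ +-cong εx≈εy (sym (-‿distribʳ-* ε y)) ⟩
    ε * y - ε * y      ≈⟨ -‿inverseʳ (ε * y) ⟩
    0#                 ∎))

  Cong-cancelScale : ∀ {ε r x y} → TorsionFree ε → Cong (r * ε) (ε * x) (ε * y) → Cong r x y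
  Cong-cancelScale {ε} {r} {x} {y} ε-regular h@(t , _) = Cong-intro t (TorsionFree-cancel ε-regular (begin
    ε * x                ≈⟨ Cong-witness h ⟩
    ε * y + (r * ε) * t  ≈⟨ +-congˡ (x∙yz≈yx∙z ε r t) ⟨
    ε * y + ε * (r * t)  ≈⟨ distribˡ ε y (r * t) ⟨
    ε * (y + r * t)      ∎))

  pow-+ : ∀ q a b → pow q (a ℕ.+ b) ≈ pow q a * pow q b
  pow-+ q zero    b = sym (*-identityˡ _)
  pow-+ q (suc a) b = trans (*-congˡ (pow-+ q a b)) (sym (*-assoc q (pow q a) (pow q b)))

  TorsionFree-pow : ∀ {q} → TorsionFree q → ∀ n → TorsionFree (pow q n)
  TorsionFree-pow q-regular zero    x e = trans (sym (*-identityˡ x)) e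
  TorsionFree-pow {q} q-regular (suc n) x e =
    TorsionFree-pow q-regular n x (q-regular _ (trans (sym (*-assoc q (pow q n) x)) e))

module PolynomialCongruence {c ℓ} (R : CommutativeRing c ℓ) where
  open CommutativeRing R hiding (zero)
  open WithRing R
  open Congruence R
  open import Algebra.Properties.CommutativeSemigroup +-commutativeSemigroup
    using () renaming (interchange to +-interchange)
  open import Algebra.Properties.CommutativeSemigroup *-commutativeSemigroup
    using (x∙yz≈y∙xz)
  open import Algebra.Properties.Ring ring using (-1*x≈-x)

  coeff-⊕ : ∀ f g n → coeff n (f ⊕ g) ≈ coeff n f + coeff n g
  coeff-⊕ []      g       n       = sym (+-identityˡ _)
  coeff-⊕ (a ∷ f) []      n       = sym (+-identityʳ _)
  coeff-⊕ (a ∷ f) (b ∷ g) zero    = refl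
  coeff-⊕ (a ∷ f) (b ∷ g) (suc n) = coeff-⊕ f g n

  coeff-scale : ∀ x f n → coeff n (scale x f) ≈ x * coeff n f
  coeff-scale x []      n       = sym (zeroʳ x)
  coeff-scale x (a ∷ f) zero    = refl
  coeff-scale x (a ∷ f) (suc n) = coeff-scale x f n

  negate : Poly → Poly
  negate = scale (- 1#)

  -- f ≋[ m ] g: f and g have the same image in (R/mR)[T].  (A record rather
  -- than PolyCong itself, so that f and g can be inferred from it.)
  record _≋[_]_ (f : Poly) (m : Carrier) (g : Poly) : Set (c ⊔ ℓ) where
    constructor coeffwise
    field at : PolyCong m f g
  open _≋[_]_ public

  module _ {m : Carrier} where
    ≋-refl : ∀ {f} → f ≋[ m ] f
    ≋-refl = coeffwise λ n → Cong-refl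

    ≋-sym : ∀ {f g} → f ≋[ m ] g → g ≋[ m ] f
    ≋-sym (coeffwise h) = coeffwise λ n → Cong-sym (h n)

    ≋-trans : ∀ {f g h} → f ≋[ m ] g → g ≋[ m ] h → f ≋[ m ] h
    ≋-trans (coeffwise h) (coeffwise h') = coeffwise λ n → Cong-trans (h n) (h' n)

    ≡⇒≋ : ∀ {f g} → f P.≡ g → f ≋[ m ] g
    ≡⇒≋ P.refl = ≋-refl

    ≈⇒≋ : ∀ {f g} → (∀ n → coeff n f ≈ coeff n g) → f ≋[ m ] g
    ≈⇒≋ h = coeffwise λ n → ≈⇒Cong (h n)

    ∷-≋ : ∀ {a b f g} → Cong m a b → f ≋[ m ] g → (a ∷ f) ≋[ m ] (b ∷ g)
    ∷-≋ a≡b (coeffwise h) = coeffwise λ { zero → a≡b ; (suc n) → h n }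

    ∷-≋⁻¹ : ∀ {a b f g} → (a ∷ f) ≋[ m ] (b ∷ g) → Cong m a b × f ≋[ m ] g
    ∷-≋⁻¹ (coeffwise h) = h zero , coeffwise (h ∘ suc)

    []≋∷ : ∀ {b g} → Cong m 0# b → [] ≋[ m ] g → [] ≋[ m ] (b ∷ g)
    []≋∷ 0≡b (coeffwise h) = coeffwise λ { zero → 0≡b ; (suc n) → h n }

    []≋∷⁻¹ : ∀ {b g} → [] ≋[ m ] (b ∷ g) → Cong m 0# b × [] ≋[ m ] g
    []≋∷⁻¹ (coeffwise h) = h zero , coeffwise (h ∘ suc)

    ⊕-≋ : ∀ {f f' g g'} → f ≋[ m ] f' → g ≋[ m ] g' → (f ⊕ g) ≋[ m ] (f' ⊕ g')
    ⊕-≋ {f} {f'} {g} {g'} (coeffwise h) (coeffwise h') = coeffwise λ n →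
      Cong-resp (coeff-⊕ f g n) (coeff-⊕ f' g' n) (Cong-+ (h n) (h' n))

    scale-≋ : ∀ {x f g} → f ≋[ m ] g → scale x f ≋[ m ] scale x g
    scale-≋ {x} {f} {g} (coeffwise h) = coeffwise λ n →
      Cong-resp (coeff-scale x f n) (coeff-scale x g n) (Cong-*ˡ x (h n))

    scale-≋ˡ : ∀ {x y f} → Cong m x y → scale x f ≋[ m ] scale y f
    scale-≋ˡ {x} {y} {f} x≡y = coeffwise λ n →
      Cong-resp (coeff-scale x f n) (coeff-scale y f n) (Cong-*ʳ (coeff n f) x≡y)

    []≋⊕ : ∀ {u v} → [] ≋[ m ] u → [] ≋[ m ] v → [] ≋[ m ] (u ⊕ v)
    []≋⊕ {u} {v} (coeffwise h) (coeffwise h') = coeffwise λ n →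
      Cong-resp (sym (+-identityʳ 0#)) (coeff-⊕ u v n) (Cong-+ (h n) (h' n))

    []≋scale : ∀ {x} u → Cong m 0# x → [] ≋[ m ] scale x u
    []≋scale {x} u 0≡x = coeffwise λ n →
      Cong-resp (sym (zeroˡ (coeff n u))) (coeff-scale x u n) (Cong-*ʳ (coeff n u) 0≡x)

    []≋⊗ : ∀ {f} h → [] ≋[ m ] f → [] ≋[ m ] (f ⊗ h)
    []≋⊗ {[]}    h f≋0 = ≋-refl
    []≋⊗ {a ∷ f} h f≋0 = let (0≡a , 0≋f) = []≋∷⁻¹ f≋0 in
      []≋⊕ ([]≋scale h 0≡a) ([]≋∷ Cong-refl ([]≋⊗ h 0≋f))

    ⊗-≋ˡ : ∀ {f f'} h → f ≋[ m ] f' → (f ⊗ h) ≋[ m ] (f' ⊗ h)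
    ⊗-≋ˡ {[]}    {[]}     h f≋f' = ≋-refl
    ⊗-≋ˡ {[]}    {b ∷ g}  h f≋f' = []≋⊗ h f≋f'
    ⊗-≋ˡ {a ∷ f} {[]}     h f≋f' = ≋-sym ([]≋⊗ h (≋-sym f≋f'))
    ⊗-≋ˡ {a ∷ f} {b ∷ g}  h f≋f' = let (a≡b , f≋g) = ∷-≋⁻¹ f≋f' in
      ⊕-≋ (scale-≋ˡ a≡b) (∷-≋ Cong-refl (⊗-≋ˡ h f≋g))

    ⊗-≋ʳ : ∀ f {h h'} → h ≋[ m ] h' → (f ⊗ h) ≋[ m ] (f ⊗ h')
    ⊗-≋ʳ []      h≋h' = ≋-refl
    ⊗-≋ʳ (a ∷ f) h≋h' = ⊕-≋ (scale-≋ h≋h') (∷-≋ Cong-refl (⊗-≋ʳ f h≋h'))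

    ∘-≋ʳ : ∀ f {h h'} → h ≋[ m ] h' → (f ∘ₚ h) ≋[ m ] (f ∘ₚ h')
    ∘-≋ʳ []      h≋h' = ≋-refl
    ∘-≋ʳ (a ∷ f) {h} {h'} h≋h' =
      ⊕-≋ ≋-refl (≋-trans (⊗-≋ˡ (f ∘ₚ h) h≋h') (⊗-≋ʳ h' (∘-≋ʳ f h≋h')))

    ⊕-[] : ∀ u → (u ⊕ []) ≋[ m ] u
    ⊕-[] u = ≈⇒≋ λ n → trans (coeff-⊕ u [] n) (+-identityʳ _)

    ⊕-comm : ∀ u v → (u ⊕ v) ≋[ m ] (v ⊕ u)
    ⊕-comm u v = ≈⇒≋ λ n →
      trans (coeff-⊕ u v n) (trans (+-comm (coeff n u) (coeff n v)) (sym (coeff-⊕ v u n)))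

    ⊕-negate : ∀ u → (u ⊕ negate u) ≋[ m ] []
    ⊕-negate u = ≈⇒≋ λ n → begin
      coeff n (u ⊕ negate u)             ≈⟨ coeff-⊕ u (negate u) n ⟩
      coeff n u + coeff n (negate u)     ≈⟨ +-congˡ (coeff-scale (- 1#) u n) ⟩
      coeff n u + - 1# * coeff n u       ≈⟨ +-congˡ (-1*x≈-x (coeff n u)) ⟩
      coeff n u - coeff n u              ≈⟨ -‿inverseʳ (coeff n u) ⟩
      0#                                 ∎
      where open SetoidReasoning setoid

    ⊕-interchange : ∀ A B C D → ((A ⊕ B) ⊕ (C ⊕ D)) ≋[ m ] ((A ⊕ C) ⊕ (B ⊕ D))
    ⊕-interchange A B C D = ≈⇒≋ λ n → begin
      coeff n ((A ⊕ B) ⊕ (C ⊕ D))                          ≈⟨ coeff-⊕ (A ⊕ B) (C ⊕ D) n ⟩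
      coeff n (A ⊕ B) + coeff n (C ⊕ D)                    ≈⟨ +-cong (coeff-⊕ A B n) (coeff-⊕ C D n) ⟩
      (coeff n A + coeff n B) + (coeff n C + coeff n D)    ≈⟨ +-interchange _ _ _ _ ⟩
      (coeff n A + coeff n C) + (coeff n B + coeff n D)    ≈⟨ +-cong (coeff-⊕ A C n) (coeff-⊕ B D n) ⟨
      coeff n (A ⊕ C) + coeff n (B ⊕ D)                    ≈⟨ coeff-⊕ (A ⊕ C) (B ⊕ D) n ⟨
      coeff n ((A ⊕ C) ⊕ (B ⊕ D))                          ∎
      where open SetoidReasoning setoid

    scale-⊕ : ∀ x u v → scale x (u ⊕ v) ≋[ m ] (scale x u ⊕ scale x v)
    scale-⊕ x u v = ≈⇒≋ λ n → begin
      coeff n (scale x (u ⊕ v))                  ≈⟨ coeff-scale x (u ⊕ v) n ⟩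
      x * coeff n (u ⊕ v)                        ≈⟨ *-congˡ (coeff-⊕ u v n) ⟩
      x * (coeff n u + coeff n v)                ≈⟨ distribˡ x _ _ ⟩
      x * coeff n u + x * coeff n v              ≈⟨ +-cong (coeff-scale x u n) (coeff-scale x v n) ⟨
      coeff n (scale x u) + coeff n (scale x v)  ≈⟨ coeff-⊕ (scale x u) (scale x v) n ⟨
      coeff n (scale x u ⊕ scale x v)            ∎
      where open SetoidReasoning setoid

    ⊗-[] : ∀ f → (f ⊗ []) ≋[ m ] []
    ⊗-[] []      = ≋-refl
    ⊗-[] (a ∷ f) = ≋-sym ([]≋∷ Cong-refl (≋-sym (⊗-[] f)))

    ⊗-⊕ : ∀ h u v → (h ⊗ (u ⊕ v)) ≋[ m ] ((h ⊗ u) ⊕ (h ⊗ v))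
    ⊗-⊕ []      u v = ≋-refl
    ⊗-⊕ (a ∷ h) u v = ≋-trans
      (⊕-≋ (scale-⊕ a u v) (∷-≋ (≈⇒Cong (sym (+-identityʳ 0#))) (⊗-⊕ h u v)))
      (⊕-interchange (scale a u) (scale a v) (0# ∷ (h ⊗ u)) (0# ∷ (h ⊗ v)))

    ∘-⊕ : ∀ f g h → ((f ⊕ g) ∘ₚ h) ≋[ m ] ((f ∘ₚ h) ⊕ (g ∘ₚ h))
    ∘-⊕ []      g       h = ≋-refl
    ∘-⊕ (a ∷ f) []      h = ≋-sym (⊕-[] _)
    ∘-⊕ (a ∷ f) (b ∷ g) h = ≋-trans
      (⊕-≋ ≋-refl (≋-trans (⊗-≋ʳ h (∘-⊕ f g h)) (⊗-⊕ h (f ∘ₚ h) (g ∘ₚ h))))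
      (⊕-interchange (a ∷ []) (b ∷ []) (h ⊗ (f ∘ₚ h)) (h ⊗ (g ∘ₚ h)))

    ⊗-scale : ∀ h x u → (h ⊗ scale x u) ≋[ m ] scale x (h ⊗ u)
    ⊗-scale []      x u = ≋-refl
    ⊗-scale (b ∷ h) x u = ≋-trans
      (⊕-≋ scale-scale (∷-≋ (≈⇒Cong (sym (zeroʳ x))) (⊗-scale h x u)))
      (≋-sym (scale-⊕ x (scale b u) (0# ∷ (h ⊗ u))))
      where
      scale-scale : scale b (scale x u) ≋[ m ] scale x (scale b u)
      scale-scale = ≈⇒≋ λ n → begin
        coeff n (scale b (scale x u))  ≈⟨ coeff-scale b (scale x u) n ⟩
        b * coeff n (scale x u)        ≈⟨ *-congˡ (coeff-scale x u n) ⟩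
        b * (x * coeff n u)            ≈⟨ x∙yz≈y∙xz b x (coeff n u) ⟩
        x * (b * coeff n u)            ≈⟨ *-congˡ (coeff-scale b u n) ⟨
        x * coeff n (scale b u)        ≈⟨ coeff-scale x (scale b u) n ⟨
        coeff n (scale x (scale b u))  ∎
        where open SetoidReasoning setoid

    scale-∘ : ∀ x f h → (scale x f ∘ₚ h) ≋[ m ] scale x (f ∘ₚ h)
    scale-∘ x []      h = ≋-refl
    scale-∘ x (a ∷ f) h = ≋-trans
      (⊕-≋ ≋-refl (≋-trans (⊗-≋ʳ h (scale-∘ x f h)) (⊗-scale h x (f ∘ₚ h))))
      (≋-sym (scale-⊕ x (a ∷ []) (h ⊗ (f ∘ₚ h))))

    ⊗-1 : ∀ f → (f ⊗ (1# ∷ [])) ≋[ m ] f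
    ⊗-1 []      = ≋-refl
    ⊗-1 (a ∷ f) = ∷-≋ (≈⇒Cong (trans (+-identityʳ _) (*-identityʳ a))) (⊗-1 f)

    X-∘ : ∀ h → (X ∘ₚ h) ≋[ m ] h
    X-∘ h = ⊕-≋ (≋-sym ([]≋∷ Cong-refl ≋-refl))
      (≋-trans (⊗-≋ʳ h (≋-trans (⊕-≋ ≋-refl (⊗-[] h)) (⊕-[] (1# ∷ [])))) (⊗-1 h))

    X-⊗ : ∀ u → (X ⊗ u) ≋[ m ] (0# ∷ u)
    X-⊗ u = ⊕-≋ (≋-sym ([]≋scale u Cong-refl))
      (∷-≋ Cong-refl (≋-trans (⊕-≋ scale-1 (≋-sym ([]≋∷ Cong-refl ≋-refl))) (⊕-[] u)))
      where
      scale-1 : scale 1# u ≋[ m ] u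
      scale-1 = ≈⇒≋ λ n → trans (coeff-scale 1# u n) (*-identityˡ _)

    ∘-X : ∀ f → (f ∘ₚ X) ≋[ m ] f
    ∘-X []      = ≋-refl
    ∘-X (a ∷ f) = ≋-trans (⊕-≋ (≋-refl {f = a ∷ []}) (≋-trans (X-⊗ (f ∘ₚ X)) (∷-≋ Cong-refl (∘-X f))))
      (∷-≋ (≈⇒Cong (+-identityʳ a)) ≋-refl)

  ≋-setoid : Carrier → Setoid c (c ⊔ ℓ)
  ≋-setoid m = record
    { Carrier       = Poly
    ; _≈_           = λ f g → f ≋[ m ] g
    ; isEquivalence = record { refl = ≋-refl ; sym = ≋-sym ; trans = ≋-trans }
    }

module Tabulation {c ℓ} (R : CommutativeRing c ℓ) where
  open CommutativeRing R hiding (zero)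
  open WithRing R
  open Congruence R
  open PolynomialCongruence R

  coeff-tabulate : ∀ {k} (i : Fin k) (g : Fin k → Carrier) → coeff (toℕ i) (tabulate g) P.≡ g i
  coeff-tabulate zero    g = P.refl
  coeff-tabulate (suc i) g = coeff-tabulate i (g ∘ suc)

  tabulate-+ : ∀ {k} (a b : Fin k → Carrier) → tabulate (λ i → a i + b i) P.≡ tabulate a ⊕ tabulate b
  tabulate-+ {zero}  a b = P.refl
  tabulate-+ {suc k} a b = P.cong (a zero + b zero ∷_) (tabulate-+ (a ∘ suc) (b ∘ suc))

  module _ {m : Carrier} where
    tabulate-≋ : ∀ {k} {a b : Fin k → Carrier} → (∀ i → Cong m (a i) (b i)) → tabulate a ≋[ m ] tabulate b
    tabulate-≋ {zero}  a≡b = ≋-refl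
    tabulate-≋ {suc k} a≡b = ∷-≋ (a≡b zero) (tabulate-≋ (a≡b ∘ suc))

    tabulate-≋⁻¹ : ∀ {k} {a b : Fin k → Carrier} → tabulate a ≋[ m ] tabulate b → ∀ i → Cong m (a i) (b i)
    tabulate-≋⁻¹ {a = a} {b} a≋b i =
      Cong-resp (reflexive (P.sym (coeff-tabulate i a))) (reflexive (P.sym (coeff-tabulate i b))) (at a≋b (toℕ i))

    padding : ∀ k f → length f ≤ k → f ≋[ m ] tabulate {n = k} (λ i → coeff (toℕ i) f)
    padding zero    []      _         = ≋-refl
    padding (suc k) []      _         = []≋∷ Cong-refl (padding k [] z≤n)
    padding (suc k) (a ∷ f) (s≤s f≤k) = ∷-≋ Cong-refl (padding k f f≤k)

    truncation : ∀ {k f} {g : Fin k → Carrier} → f ≋[ m ] tabulate g →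
                 f ≋[ m ] tabulate (λ i → coeff (toℕ i) f)
    truncation {f = f} {g} f≋g = ≋-trans f≋g (tabulate-≋ λ i →
      Cong-resp (reflexive (P.sym (coeff-tabulate i g))) refl (Cong-sym (at f≋g (toℕ i))))

    tabulation-determined : ∀ {k f h} {g g' : Fin k → Carrier} →
      f ≋[ m ] tabulate g → h ≋[ m ] tabulate g' →
      (∀ (i : Fin k) → Cong m (coeff (toℕ i) f) (coeff (toℕ i) h)) → f ≋[ m ] h
    tabulation-determined f≋g h≋g' f≡h =
      ≋-trans (truncation f≋g) (≋-trans (tabulate-≋ f≡h) (≋-sym (truncation h≋g')))

module Perturbation {c ℓ} (R : CommutativeRing c ℓ) where
  open CommutativeRing R hiding (zero)
  open WithRing R
  open Congruence R
  open PolynomialCongruence R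
  open Tabulation R
  open Solver R

  perturb : Carrier → Poly → Poly
  perturb ε A = X ⊕ scale ε A

  coeff-perturb : ∀ ε A n → coeff n (perturb ε A) ≈ coeff n X + ε * coeff n A
  coeff-perturb ε A n = trans (coeff-⊕ X (scale ε A) n) (+-congˡ (coeff-scale ε A n))

  scale-≋-modulus : ∀ ε {r u v} → u ≋[ r ] v → scale ε u ≋[ r * ε ] scale ε v
  scale-≋-modulus ε {r} {u} {v} (coeffwise h) = coeffwise λ n →
    Cong-resp (coeff-scale ε u n) (coeff-scale ε v n) (Cong-scale ε (h n))

  ≋-divides : ∀ {m r f g} → Divides m r → f ≋[ r ] g → f ≋[ m ] g
  ≋-divides m∣r (coeffwise h) = coeffwise λ n → Cong-divides m∣r (h n)

  perturb-≋X : ∀ ε A → perturb ε A ≋[ ε ] X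
  perturb-≋X ε A = coeffwise λ n → Cong-resp (coeff-perturb ε A n) refl (Cong-addMultiple (coeff n X) _)

  perturb-≋ : ∀ ε {r A B} → A ≋[ r ] B → perturb ε A ≋[ r * ε ] perturb ε B
  perturb-≋ ε A≋B = ⊕-≋ ≋-refl (scale-≋-modulus ε A≋B)

  perturb-≋⁻¹ : ∀ {ε r A B} → TorsionFree ε → perturb ε A ≋[ r * ε ] perturb ε B → A ≋[ r ] B
  perturb-≋⁻¹ {ε} {r} {A} {B} ε-regular (coeffwise h) = coeffwise λ n →
    Cong-cancelScale ε-regular (Cong-cancelˡ (coeff n X)
      (Cong-resp (sym (coeff-perturb ε A n)) (sym (coeff-perturb ε B n)) (h n)))

  perturb-⊕ : ∀ {m} ε A B → (perturb ε B ⊕ scale ε A) ≋[ m ] perturb ε (A ⊕ B)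
  perturb-⊕ ε A B = ≈⇒≋ λ n → begin
    coeff n (perturb ε B ⊕ scale ε A)              ≈⟨ coeff-⊕ (perturb ε B) (scale ε A) n ⟩
    coeff n (perturb ε B) + coeff n (scale ε A)    ≈⟨ +-cong (coeff-perturb ε B n) (coeff-scale ε A n) ⟩
    (coeff n X + ε * coeff n B) + ε * coeff n A    ≈⟨ solve 4 (λ x e b a → ((x :+ (e :* b)) :+ (e :* a)) ⊜ (x :+ (e :* (a :+ b)))) refl (coeff n X) ε (coeff n B) (coeff n A) ⟩
    coeff n X + ε * (coeff n A + coeff n B)        ≈⟨ +-congˡ (*-congˡ (coeff-⊕ A B n)) ⟨
    coeff n X + ε * coeff n (A ⊕ B)                ≈⟨ coeff-perturb ε (A ⊕ B) n ⟨
    coeff n (perturb ε (A ⊕ B))                    ∎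
    where open SetoidReasoning setoid

  -- The first-order composition law: modulo any m dividing ε²,
  -- (T + εA) ∘ (T + εB) ≡ T + ε(A + B), because A(T + εB) ≡ A (mod ε).
  perturb-∘ : ∀ {m ε} → Divides m (ε * ε) → ∀ A B →
              (perturb ε A ∘ₚ perturb ε B) ≋[ m ] perturb ε (A ⊕ B)
  perturb-∘ {m} {ε} m∣ε² A B = begin
    perturb ε A ∘ₚ Q               ≈⟨ ∘-⊕ X (scale ε A) Q ⟩
    (X ∘ₚ Q) ⊕ (scale ε A ∘ₚ Q)    ≈⟨ ⊕-≋ (X-∘ Q) (scale-∘ ε A Q) ⟩
    Q ⊕ scale ε (A ∘ₚ Q)           ≈⟨ ⊕-≋ ≋-refl (≋-divides m∣ε² (scale-≋-modulus ε A∘Q≋A)) ⟩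
    Q ⊕ scale ε A                  ≈⟨ perturb-⊕ ε A B ⟩
    perturb ε (A ⊕ B)              ∎
    where
    Q : Poly
    Q = perturb ε B
    A∘Q≋A : (A ∘ₚ Q) ≋[ ε ] A
    A∘Q≋A = ≋-trans (∘-≋ʳ A (perturb-≋X ε B)) (∘-X A)
    open SetoidReasoning (≋-setoid m)

  perturb-≋[] : ∀ {m} ε {A} → A ≋[ m ] [] → perturb ε A ≋[ m ] X
  perturb-≋[] ε A≋0 = ≋-trans (⊕-≋ ≋-refl (scale-≋ A≋0)) (⊕-[] X)

  perturb-invertible : ∀ {m ε} → Divides m (ε * ε) → ∀ A → InvertibleMod m (perturb ε A)
  perturb-invertible m∣ε² A =
      perturb _ (negate A)
    , at (≋-trans (perturb-∘ m∣ε² A (negate A)) (perturb-≋[] _ (⊕-negate A)))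
    , at (≋-trans (perturb-∘ m∣ε² (negate A) A) (perturb-≋[] _ (≋-trans (⊕-comm (negate A) A) (⊕-negate A))))

  perturb-tabulate : ∀ {m} ε {j} (a : Fin (suc (suc j)) → Carrier) →
    perturb ε (tabulate a) ≋[ m ] tabulate (λ i → coeff (toℕ i) X + ε * a i)
  perturb-tabulate ε {j} a = ≋-trans
    (⊕-≋ (padding (suc (suc j)) X (s≤s (s≤s z≤n))) (≡⇒≋ (map-tabulate a (ε *_))))
    (≡⇒≋ (P.sym (tabulate-+ (λ i → coeff (toℕ i) X) (λ i → ε * a i))))

  -- Conversely, a polynomial congruent modulo m to a list of length j + 2 and
  -- reducing to T modulo ε is a perturbation of T by such a list: its i-th
  -- entry is the quotient ([f]_i − [T]_i)/ε.
  ≋X⇒perturb : ∀ {m ε j f} {g : Fin (suc (suc j)) → Carrier} → f ≋[ m ] tabulate g → PolyCong ε f X →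
    ∃ λ (α : Fin (suc (suc j)) → Carrier) → f ≋[ m ] perturb ε (tabulate α)
  ≋X⇒perturb {m} {ε} {j} {f} {g} f≋g f≡X = α ,
    tabulation-determined {g = g} {g' = λ i → coeff (toℕ i) X + ε * α i} f≋g (perturb-tabulate ε α) λ i → ≈⇒Cong (begin
      coeff (toℕ i) f                                    ≈⟨ Cong-witness (f≡X (toℕ i)) ⟩
      coeff (toℕ i) X + ε * α i                          ≈⟨ +-congˡ (*-congˡ (reflexive (P.sym (coeff-tabulate i α)))) ⟩
      coeff (toℕ i) X + ε * coeff (toℕ i) (tabulate α)   ≈⟨ coeff-perturb ε (tabulate α) (toℕ i) ⟨
      coeff (toℕ i) (perturb ε (tabulate α))             ∎)
    where
    α : Fin (suc (suc j)) → Carrier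
    α i = proj₁ (f≡X (toℕ i))
    open SetoidReasoning setoid

-- The perturbations occurring in N_d for d = k + 2: here ε = q^(d-1) and the
-- modulus q^d is q·ε (definitionally).
module Kernel {c ℓ} (R : CommutativeRing c ℓ) (q : CommutativeRing.Carrier R) (k : ℕ) where
  open CommutativeRing R hiding (zero)
  open WithRing R
  open Congruence R
  open PolynomialCongruence R
  open Tabulation R
  open Perturbation R

  d : ℕ
  d = suc (suc k)

  ε : Carrier
  ε = pow q (suc k)

  -- 2(d − 1) ≥ d, so q^d divides ε².
  q^d∣ε² : Divides (pow q d) (ε * ε)
  q^d∣ε² = pow q k , trans (sym (*-assoc ε q (pow q k))) (*-congʳ (*-comm ε q))

  shapeCoefficients : (Fin (suc d) → Carrier) → Fin (suc d) → Carrier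
  shapeCoefficients a zero           = ε * a zero
  shapeCoefficients a (suc zero)     = 1# + ε * a (suc zero)
  shapeCoefficients a (suc (suc j))  = pow q (k ∸ toℕ j) * a (suc (suc j))

  shapeCoefficients-spec : ∀ a i → coeff (toℕ i) X + ε * a i ≈ pow q (toℕ i ∸ 1) * shapeCoefficients a i
  shapeCoefficients-spec a zero          = trans (+-identityˡ _) (sym (*-identityˡ _))
  shapeCoefficients-spec a (suc zero)    = sym (*-identityˡ _)
  shapeCoefficients-spec a (suc (suc j)) = begin
    0# + ε * a (suc (suc j))                                       ≈⟨ +-identityˡ _ ⟩
    pow q (suc k) * a (suc (suc j))                                ≈⟨ *-congʳ (reflexive (P.cong (pow q ∘ suc) (P.sym j+[k∸j]≡k))) ⟩
    pow q (suc (toℕ j) ℕ.+ (k ∸ toℕ j)) * a (suc (suc j))          ≈⟨ *-congʳ (pow-+ q (suc (toℕ j)) (k ∸ toℕ j)) ⟩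
    (pow q (suc (toℕ j)) * pow q (k ∸ toℕ j)) * a (suc (suc j))    ≈⟨ *-assoc _ _ _ ⟩
    pow q (suc (toℕ j)) * (pow q (k ∸ toℕ j) * a (suc (suc j)))    ∎
    where
    open SetoidReasoning setoid
    j+[k∸j]≡k : toℕ j ℕ.+ (k ∸ toℕ j) P.≡ k
    j+[k∸j]≡k = m+[n∸m]≡n (toℕ≤pred[n] j)

  nEmbed∈N : ∀ a → InN q d (nEmbed q d a)
  nEmbed∈N a = (perturb-invertible q^d∣ε² (tabulate a) , shapeCoefficients a , at shape) , at (perturb-≋X ε (tabulate a))
    where
    shape : nEmbed q d a ≋[ pow q d ] shapePoly q d (shapeCoefficients a)
    shape = ≋-trans (perturb-tabulate ε a) (tabulate-≋ λ i → ≈⇒Cong (shapeCoefficients-spec a i))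

  N⊆nEmbed : ∀ f → InN q d f → ∃ λ (α : Fin (suc d) → Carrier) → PolyCong (pow q d) f (nEmbed q d α)
  N⊆nEmbed f ((_ , b , f≡shape) , f≡X) =
    let (α , f≋α) = ≋X⇒perturb {f = f} {g = λ i → pow q (toℕ i ∸ 1) * b i} (coeffwise f≡shape) f≡X
    in α , at f≋α

lemma4p2 : ∀ {c ℓ} (R : CommutativeRing c ℓ) (q : CommutativeRing.Carrier R) (d : ℕ) →
    let open CommutativeRing R
        open WithRing R
    in TorsionFree q → PrincipalPrime q → 2 ≤ d →
       (∀ (a : Fin (suc d) → Carrier) → InN q d (nEmbed q d a))
       × (∀ (f : Poly) → InN q d f → ∃ λ (a : Fin (suc d) → Carrier) → PolyCong (pow q d) f (nEmbed q d a))
       × (∀ (a b : Fin (suc d) → Carrier) →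
            (PolyCong (pow q d) (nEmbed q d a) (nEmbed q d b) → ∀ i → Cong q (a i) (b i))
            × ((∀ i → Cong q (a i) (b i)) → PolyCong (pow q d) (nEmbed q d a) (nEmbed q d b)))
       × (∀ (a b : Fin (suc d) → Carrier) →
            PolyCong (pow q d) (nEmbed q d a ∘ₚ nEmbed q d b) (nEmbed q d (λ i → a i + b i)))
lemma4p2 R q (suc (suc k)) q-regular _ (s≤s (s≤s z≤n)) =
    nEmbed∈N
  , N⊆nEmbed
    -- T + εa ≡ T + εb (mod qε) iff a ≡ b (mod q), ε being a non-zero-divisor
  , (λ a b → (λ h → tabulate-≋⁻¹ (perturb-≋⁻¹ (TorsionFree-pow q-regular (suc k)) (coeffwise h)))
           , (λ a≡b → at (perturb-≋ ε (tabulate-≋ a≡b))))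
  , (λ a b → at (≋-trans (perturb-∘ q^d∣ε² (tabulate a) (tabulate b))
                         (≡⇒≋ (P.cong (perturb ε) (P.sym (tabulate-+ a b))))))
  where
  open Congruence R
  open PolynomialCongruence R
  open Tabulation R
  open Perturbation R
  open Kernel R q k
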